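{- For every positive integer $n$, $\mathsf{sam}\big(\mathcal{G}^{\mathrm{cliq}}_{6n},1/4\big)\geq n^{2/3}/3$.
   Context: For a finite set $\Lambda$, a nonempty family $\mathcal{H}$ of functions $\Lambda\to\{0,1\}$ (subsets identified with indicator functions) and $\varepsilon\in(0,1)$, $\mathsf{sam}(\mathcal{H},\varepsilon)$ is the minimum positive integer $m$ such that some algorithm, for every distribution $\mu$ on $\Lambda$ and every $f:\Lambda\to\{0,1\}$, given $m$ labeled samples $(x^{(i)},f(x^{(i)}))$ with $x^{(i)}$ drawn independently from $\mu$, accepts with probability at least $2/3$ if $f\in\mathcal{H}$ and rejects with probability at least $2/3$ if $\Pr_{x\sim\mu}[f(x)\neq g(x)]\geq\varepsilon$ for all $g\in\mathcal{H}$. Here $\Lambda=\binom{[N]}{2}$ with $N=6n$, and $\mathcal{G}^{\mathrm{cliq}}_{N}$ is the collection of edge sets of the form $\binom{S}{2}$ with $S\subseteq[N]$ (edge sets of cliques).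
   Formalization: Only algorithms whose acceptance probability on each labeled sample sequence is rational are ruled out, and the distributions μ in the acceptance and rejection conditions take rational values. -}

module Defs where

open import Data.Nat as ℕ using (ℕ; zero; suc)
open import Data.Bool using (Bool; true; false; _∧_; _xor_; if_then_else_)
open import Data.Fin using (Fin) renaming (_<_ to _<ᶠ_)
open import Data.Fin.Properties using () renaming (_<?_ to _<ᶠ?_)
open import Data.List using (List; []; _∷_; concatMap; map; filter; allFin; cartesianProduct)
open import Data.Vec as Vec using (Vec; []; _∷_)
open import Data.Product using (_×_; _,_; proj₁; proj₂; Σ; ∃)
open import Data.Integer using (+_)
open import Data.Rational using (ℚ; 0ℚ; 1ℚ; _+_; _*_; _≤_; _/_)
open import Relation.Binary.PropositionalEquality using (_≡_)
open import Data.List.Membership.Propositional using (_∈_)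

sumL : {X : Set} → List X → (X → ℚ) → ℚ
sumL []       g = 0ℚ
sumL (x ∷ xs) g = g x + sumL xs g

prodV : {X : Set} {m : ℕ} → Vec X m → (X → ℚ) → ℚ
prodV []       g = 1ℚ
prodV (x ∷ xs) g = g x * prodV xs g

seqs : {X : Set} → List X → (m : ℕ) → List (Vec X m)
seqs xs zero    = [] ∷ []
seqs xs (suc m) = concatMap (λ x → map (x ∷_) (seqs xs m)) xs

-- Distribution testing over a finite domain Λ, given as a duplicate-free
-- list `dom` of elements of a carrier type X.  Probabilities are rational.

IsDist : {X : Set} → List X → (X → ℚ) → Set
IsDist dom μ = (∀ x → 0ℚ ≤ μ x) × (sumL dom μ ≡ 1ℚ)

neq : Bool → Bool → ℚ
neq a b = if a xor b then 1ℚ else 0ℚ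

dist : {X : Set} → List X → (X → ℚ) → (X → Bool) → (X → Bool) → ℚ
dist dom μ f g = sumL dom (λ x → μ x * neq (f x) (g x))

-- A (randomized) algorithm with m labeled samples: its acceptance
-- probability as a function of the sample sequence.
Algorithm : Set → ℕ → Set
Algorithm X m = Vec (X × Bool) m → ℚ

ValidAlg : {X : Set} {m : ℕ} → Algorithm X m → Set
ValidAlg A = ∀ s → (0ℚ ≤ A s) × (A s ≤ 1ℚ)

accProb : {X : Set} {m : ℕ} → List X → (X → ℚ) → (X → Bool) → Algorithm X m → ℚ
accProb {m = m} dom μ f A =
  sumL (seqs dom m) (λ v → prodV v μ * A (Vec.map (λ x → x , f x) v))

IsTester : {X : Set} {m : ℕ} → List X → ((X → Bool) → Set) → ℚ → Algorithm X m → Set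
IsTester dom H ε A =
  ValidAlg A ×
  (∀ μ → IsDist dom μ → ∀ f →
     (H f → (+ 2 / 3) ≤ accProb dom μ f A) ×
     ((∀ g → H g → ε ≤ dist dom μ f g) → accProb dom μ f A ≤ (+ 1 / 3)))

-- Λ = binom([N],2): edges represented as pairs (i , j) with i < j.

Pair : ℕ → Set
Pair N = Fin N × Fin N

edges : (N : ℕ) → List (Pair N)
edges N = filter (λ p → proj₁ p <ᶠ? proj₂ p) (cartesianProduct (allFin N) (allFin N))

-- G^cliq_N : labelings of Λ that are edge sets binom(S,2) of a clique S ⊆ [N]
-- (equality required on Λ only; values off Λ are never used).
IsClique : (N : ℕ) → (Pair N → Bool) → Set
IsClique N f = ∃ λ (S : Fin N → Bool) →
  ∀ p → p ∈ edges N → f p ≡ (S (proj₁ p) ∧ S (proj₂ p))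

-- Embed n vertex-disjoint copies of K4 (the gadgets) in [6n] and let μ be uniform on their 6n
-- edges. Pick a vertex x in each gadget. Labelling every gadget by the triangle opposite x gives a
-- clique, while labelling it by the star at x is 1/3-far from all cliques, since a star and a
-- clique disagree on at least two of the six edges of K4. Swapping the endpoints of both edges of
-- one of the three perfect matchings j of K4 sends every other edge to its complement, so outside
-- j the triangle opposite x is the star at the swapped vertex. Two samples in a gadget miss some
-- matching, hence for uniform x they cannot tell triangle from star. Turning the gadgets from
-- triangles into stars one at a time thus changes the acceptance probability only through gadgets
-- hit by three samples, an event of probability at most m³/n³ each and m³/n² in total, which is
-- below the gap 1/3 between acceptance on cliques and on far labellings.

module Submission where

open import Data.Nat as ℕ using (ℕ; zero; suc; _≤ᵇ_)
import Data.Nat.Properties as ℕ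
open import Defs

module FiniteProbability where

  open import Algebra.Bundles using (CommutativeRing)
  open import Data.Bool using (Bool; true; false; if_then_else_; T)
  open import Data.Fin using (Fin; zero; suc)
  open import Data.Integer using (+_)
  open import Data.List using (List; []; _∷_; _++_; map; concatMap; cartesianProduct; length; allFin)
  open import Data.List.Properties using (length-tabulate; length-map; length-++-≤ˡ)
  open import Data.List.Membership.Propositional using (_∈_)
  open import Data.List.Relation.Unary.All as ListAll using ([]; _∷_)
  open import Data.List.Relation.Unary.Any using (here; there)
  open import Data.List.Relation.Unary.Unique.Propositional using (Unique; []; _∷_)
  open import Data.Product using (_×_; _,_)
  open import Data.Rational hiding (_≤ᵇ_)
  open import Data.Rational.Properties
  open import Data.Rational.Solver using (module +-*-Solver)
  open import Data.Vec as Vec using (Vec; []; _∷_; _[_]≔_; count)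
  open import Function using (_∘_)
  open import Relation.Binary.Definitions using (DecidableEquality)
  open import Relation.Binary.PropositionalEquality
  open import Relation.Nullary using (does; yes; no; contradiction)
  open import Relation.Nullary.Decidable using (dec-true; dec-false)
  open import Relation.Unary using (Decidable)

  open import Algebra.Properties.Semiring.Mult (CommutativeRing.semiring +-*-commutativeRing)
    using (×-homo-+; ×1-homo-*) renaming (_×_ to _×ℚ_)
  open import Algebra.Definitions.RawSemiring +-*-rawSemiring using () renaming (_^_ to _^ℚ_)

  private variable X Y : Set

  suc-≤ᵇ-suc : ∀ t c → (suc t ≤ᵇ suc c) ≡ (t ≤ᵇ c)
  suc-≤ᵇ-suc zero    c = refl
  suc-≤ᵇ-suc (suc t) c = refl

  suc-≤ᵇ-≢ : ∀ {k m} → k ≢ m → (suc k ≤ᵇ m) ≡ (k ≤ᵇ m)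
  suc-≤ᵇ-≢ {k} {m} k≢m with k ℕ.≤? m
  ... | yes k≤m =
    trans (dec-true (suc k ℕ.≤? m) (ℕ.≤∧≢⇒< k≤m k≢m)) (sym (dec-true (k ℕ.≤? m) k≤m))
  ... | no  k≰m =
    trans (dec-false (suc k ℕ.≤? m) (k≰m ∘ ℕ.<⇒≤)) (sym (dec-false (k ℕ.≤? m) k≰m))

  ≤ᵇ≡false⇒> : ∀ {k m} → (k ≤ᵇ m) ≡ false → m ℕ.< k
  ≤ᵇ≡false⇒> k≰ᵇm = ℕ.≰⇒> (λ k≤m → subst T k≰ᵇm (ℕ.≤⇒≤ᵇ k≤m))

  m^t+m^[1+t]≤[1+m]^[1+t] : ∀ m t → m ℕ.^ t ℕ.+ m ℕ.^ suc t ℕ.≤ suc m ℕ.^ suc t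
  m^t+m^[1+t]≤[1+m]^[1+t] m t =
    ℕ.+-mono-≤ (ℕ.^-monoˡ-≤ t (ℕ.n≤1+n m)) (ℕ.*-monoʳ-≤ m (ℕ.^-monoˡ-≤ t (ℕ.n≤1+n m)))

  fromℕ : ℕ → ℚ
  fromℕ k = k ×ℚ 1ℚ

  fromℕ-+ : ∀ a b → fromℕ (a ℕ.+ b) ≡ fromℕ a + fromℕ b
  fromℕ-+ = ×-homo-+ 1ℚ

  fromℕ-* : ∀ a b → fromℕ (a ℕ.* b) ≡ fromℕ a * fromℕ b
  fromℕ-* = ×1-homo-*

  0≤1 : 0ℚ ≤ 1ℚ
  0≤1 = <⇒≤ (positive⁻¹ 1ℚ)

  p≤p+q : ∀ {p q} → 0ℚ ≤ q → p ≤ p + q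
  p≤p+q {p} 0≤q = ≤-trans (≤-reflexive (sym (+-identityʳ p))) (+-monoʳ-≤ p 0≤q)

  p≤q+p : ∀ {p q} → 0ℚ ≤ q → p ≤ q + p
  p≤q+p {p} {q} 0≤q = ≤-trans (p≤p+q 0≤q) (≤-reflexive (+-comm p q))

  *-monoˡ-≤-0≤ : ∀ {r p q} → 0ℚ ≤ r → p ≤ q → r * p ≤ r * q
  *-monoˡ-≤-0≤ {r} 0≤r = *-monoˡ-≤-nonNeg r {{nonNegative 0≤r}}

  *-monoʳ-≤-0≤ : ∀ {r p q} → 0ℚ ≤ r → p ≤ q → p * r ≤ q * r
  *-monoʳ-≤-0≤ {r} 0≤r = *-monoʳ-≤-nonNeg r {{nonNegative 0≤r}}

  *-nonNeg : ∀ {p q} → 0ℚ ≤ p → 0ℚ ≤ q → 0ℚ ≤ p * q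
  *-nonNeg {p} {q} 0≤p 0≤q =
    nonNegative⁻¹ (p * q) {{nonNeg*nonNeg⇒nonNeg p {{nonNegative 0≤p}} q {{nonNegative 0≤q}}}}

  ^ℚ-nonNeg : ∀ {q} → 0ℚ ≤ q → ∀ k → 0ℚ ≤ q ^ℚ k
  ^ℚ-nonNeg 0≤q zero    = 0≤1
  ^ℚ-nonNeg 0≤q (suc k) = *-nonNeg 0≤q (^ℚ-nonNeg 0≤q k)

  fromℕ-nonNeg : ∀ k → 0ℚ ≤ fromℕ k
  fromℕ-nonNeg zero    = ≤-refl
  fromℕ-nonNeg (suc k) = ≤-trans 0≤1 (p≤p+q (fromℕ-nonNeg k))

  fromℕ-mono-≤ : ∀ {a b} → a ℕ.≤ b → fromℕ a ≤ fromℕ b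
  fromℕ-mono-≤ {b = b} ℕ.z≤n = fromℕ-nonNeg b
  fromℕ-mono-≤ (ℕ.s≤s a≤b)   = +-monoʳ-≤ 1ℚ (fromℕ-mono-≤ a≤b)

  fromℕ-mono-< : ∀ {a b} → a ℕ.< b → fromℕ a < fromℕ b
  fromℕ-mono-< {a} (ℕ.s≤s a≤b) = <-≤-trans
    (<-respˡ-≡ (+-identityˡ (fromℕ a)) (+-monoˡ-< (fromℕ a) (positive⁻¹ 1ℚ)))
    (+-monoʳ-≤ 1ℚ (fromℕ-mono-≤ a≤b))

  sumL-cong : (xs : List X) {g h : X → ℚ} → (∀ x → g x ≡ h x) → sumL xs g ≡ sumL xs h
  sumL-cong []       g≡h = refl
  sumL-cong (x ∷ xs) g≡h = cong₂ _+_ (g≡h x) (sumL-cong xs g≡h)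

  sumL-mono : (xs : List X) {g h : X → ℚ} → (∀ x → g x ≤ h x) → sumL xs g ≤ sumL xs h
  sumL-mono []       g≤h = ≤-refl
  sumL-mono (x ∷ xs) g≤h = +-mono-≤ (g≤h x) (sumL-mono xs g≤h)

  sumL-zero : (xs : List X) → sumL xs (λ _ → 0ℚ) ≡ 0ℚ
  sumL-zero []       = refl
  sumL-zero (x ∷ xs) = trans (+-identityˡ _) (sumL-zero xs)

  sumL-nonNeg : (xs : List X) {g : X → ℚ} → (∀ x → 0ℚ ≤ g x) → 0ℚ ≤ sumL xs g
  sumL-nonNeg xs 0≤g = ≤-trans (≤-reflexive (sym (sumL-zero xs))) (sumL-mono xs 0≤g)

  sumL-++ : (xs ys : List X) (g : X → ℚ) → sumL (xs ++ ys) g ≡ sumL xs g + sumL ys g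
  sumL-++ []       ys g = sym (+-identityˡ _)
  sumL-++ (x ∷ xs) ys g = trans (cong (λ s → g x + s) (sumL-++ xs ys g)) (sym (+-assoc (g x) _ _))

  sumL-+ : (xs : List X) (g h : X → ℚ) → sumL xs (λ x → g x + h x) ≡ sumL xs g + sumL xs h
  sumL-+ []       g h = sym (+-identityˡ 0ℚ)
  sumL-+ (x ∷ xs) g h = trans (cong (λ s → g x + h x + s) (sumL-+ xs g h))
    (solve 4 (λ a b c d → (a :+ b) :+ (c :+ d) := (a :+ c) :+ (b :+ d)) refl
      (g x) (h x) (sumL xs g) (sumL xs h))
    where open +-*-Solver

  sumL-*ˡ : (xs : List X) (r : ℚ) (g : X → ℚ) → sumL xs (λ x → r * g x) ≡ r * sumL xs g
  sumL-*ˡ []       r g = sym (*-zeroʳ r)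
  sumL-*ˡ (x ∷ xs) r g =
    trans (cong (λ s → r * g x + s) (sumL-*ˡ xs r g)) (sym (*-distribˡ-+ r (g x) _))

  sumL-*ʳ : (xs : List X) (r : ℚ) (g : X → ℚ) → sumL xs (λ x → g x * r) ≡ sumL xs g * r
  sumL-*ʳ xs r g = trans (sumL-cong xs (λ x → *-comm (g x) r))
                         (trans (sumL-*ˡ xs r g) (*-comm r (sumL xs g)))

  sumL-const : (xs : List X) (c : ℚ) → sumL xs (λ _ → c) ≡ fromℕ (length xs) * c
  sumL-const []       c = sym (*-zeroˡ c)
  sumL-const (x ∷ xs) c = begin
    c + sumL xs (λ _ → c)           ≡⟨ cong (λ s → c + s) (sumL-const xs c) ⟩
    c + fromℕ (length xs) * c       ≡⟨ cong (_+ fromℕ (length xs) * c) (*-identityˡ c) ⟨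
    1ℚ * c + fromℕ (length xs) * c  ≡⟨ *-distribʳ-+ c 1ℚ (fromℕ (length xs)) ⟨
    fromℕ (length (x ∷ xs)) * c     ∎
    where open ≡-Reasoning

  sumL-allFin-const : ∀ k (c : ℚ) → sumL (allFin k) (λ _ → c) ≡ fromℕ k * c
  sumL-allFin-const k c =
    trans (sumL-const (allFin k) c) (cong (λ l → fromℕ l * c) (length-tabulate {n = k} (λ i → i)))

  sumL-swap : (xs : List X) (ys : List Y) (h : X → Y → ℚ) →
              sumL xs (λ x → sumL ys (h x)) ≡ sumL ys (λ y → sumL xs (λ x → h x y))
  sumL-swap []       ys h = sym (sumL-zero ys)
  sumL-swap (x ∷ xs) ys h =
    trans (cong (λ s → sumL ys (h x) + s) (sumL-swap xs ys h)) (sym (sumL-+ ys (h x) _))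

  sumL-map : (f : Y → X) (ys : List Y) (g : X → ℚ) → sumL (map f ys) g ≡ sumL ys (g ∘ f)
  sumL-map f []       g = refl
  sumL-map f (y ∷ ys) g = cong (λ s → g (f y) + s) (sumL-map f ys g)

  sumL-concatMap : (f : Y → List X) (ys : List Y) (g : X → ℚ) →
                   sumL (concatMap f ys) g ≡ sumL ys (λ y → sumL (f y) g)
  sumL-concatMap f []       g = refl
  sumL-concatMap f (y ∷ ys) g =
    trans (sumL-++ (f y) _ g) (cong (λ s → sumL (f y) g + s) (sumL-concatMap f ys g))

  sumL-cartesianProduct : (xs : List X) (ys : List Y) (g : X × Y → ℚ) →
    sumL (cartesianProduct xs ys) g ≡ sumL xs (λ x → sumL ys (λ y → g (x , y)))
  sumL-cartesianProduct []       ys g = refl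
  sumL-cartesianProduct (x ∷ xs) ys g = trans (sumL-++ (map (x ,_) ys) _ g)
    (cong₂ _+_ (sumL-map (x ,_) ys g) (sumL-cartesianProduct xs ys g))

  sumL-if-≟-absent : (_≟_ : DecidableEquality X) {xs : List X} {a : X} → ListAll.All (a ≢_) xs →
                     (g : X → ℚ) → sumL xs (λ x → if does (x ≟ a) then g x else 0ℚ) ≡ 0ℚ
  sumL-if-≟-absent _≟_ []                           g = refl
  sumL-if-≟-absent _≟_ {x ∷ _} {a} (a≢x ∷ a∉xs) g with x ≟ a
  ... | yes x≡a = contradiction (sym x≡a) a≢x
  ... | no  _   = trans (+-identityˡ _) (sumL-if-≟-absent _≟_ a∉xs g)

  sumL-if-≟ : (_≟_ : DecidableEquality X) {xs : List X} → Unique xs → ∀ {a} → a ∈ xs →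
              (g : X → ℚ) → sumL xs (λ x → if does (x ≟ a) then g x else 0ℚ) ≡ g a
  sumL-if-≟ _≟_ {x ∷ xs} (x≢xs ∷ _) (here refl) g with x ≟ x
  ... | yes _  = trans (cong (λ s → g x + s) (sumL-if-≟-absent _≟_ x≢xs g)) (+-identityʳ (g x))
  ... | no x≢x = contradiction refl x≢x
  sumL-if-≟ _≟_ {x ∷ xs} (x≢xs ∷ unique) {a} (there a∈xs) g with x ≟ a
  ... | yes refl = contradiction refl (ListAll.lookup x≢xs a∈xs)
  ... | no  _    = trans (+-identityˡ _) (sumL-if-≟ _≟_ unique a∈xs g)

  sumL-seqs : (xs : List X) (m : ℕ) (h : Vec X (suc m) → ℚ) →
    sumL (seqs xs (suc m)) h ≡ sumL xs (λ x → sumL (seqs xs m) (λ v → h (x ∷ v)))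
  sumL-seqs xs m h = trans (sumL-concatMap _ xs h)
    (sumL-cong xs (λ x → sumL-map (x ∷_) (seqs xs m) h))

  seqs-nonempty : ∀ {x : X} xs m → 0 ℕ.< length (seqs (x ∷ xs) m)
  seqs-nonempty xs zero            = ℕ.s≤s ℕ.z≤n
  seqs-nonempty {x = x} xs (suc m) = ℕ.<-≤-trans
    (subst (0 ℕ.<_) (sym (length-map (x ∷_) (seqs (x ∷ xs) m))) (seqs-nonempty xs m))
    (length-++-≤ˡ (map (x ∷_) (seqs (x ∷ xs) m)))

  sumL-seqs-update : (xs : List X) {K : ℕ} (i : Fin K) (h : Vec X K → ℚ) →
    sumL (seqs xs K) (λ c → sumL xs (λ x → h (c [ i ]≔ x)))
      ≡ fromℕ (length xs) * sumL (seqs xs K) h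
  sumL-seqs-update xs {suc K} zero h = begin
    sumL (seqs xs (suc K)) (λ c → sumL xs (λ x → h (c [ zero ]≔ x)))
      ≡⟨ sumL-seqs xs K _ ⟩
    sumL xs (λ _ → sumL (seqs xs K) (λ c → sumL xs (λ x → h (x ∷ c))))
      ≡⟨ sumL-cong xs (λ _ → sumL-swap (seqs xs K) xs _) ⟩
    sumL xs (λ _ → sumL xs (λ x → sumL (seqs xs K) (λ c → h (x ∷ c))))
      ≡⟨ sumL-cong xs (λ _ → sumL-seqs xs K h) ⟨
    sumL xs (λ _ → sumL (seqs xs (suc K)) h)
      ≡⟨ sumL-const xs _ ⟩
    fromℕ (length xs) * sumL (seqs xs (suc K)) h ∎
    where open ≡-Reasoning
  sumL-seqs-update xs {suc K} (suc i) h = begin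
    sumL (seqs xs (suc K)) (λ c → sumL xs (λ x → h (c [ suc i ]≔ x)))
      ≡⟨ sumL-seqs xs K _ ⟩
    sumL xs (λ y → sumL (seqs xs K) (λ c → sumL xs (λ x → h (y ∷ c [ i ]≔ x))))
      ≡⟨ sumL-cong xs (λ y → sumL-seqs-update xs i (λ c → h (y ∷ c))) ⟩
    sumL xs (λ y → fromℕ (length xs) * sumL (seqs xs K) (λ c → h (y ∷ c)))
      ≡⟨ sumL-*ˡ xs (fromℕ (length xs)) _ ⟩
    fromℕ (length xs) * sumL xs (λ y → sumL (seqs xs K) (λ c → h (y ∷ c)))
      ≡⟨ cong (fromℕ (length xs) *_) (sumL-seqs xs K h) ⟨
    fromℕ (length xs) * sumL (seqs xs (suc K)) h ∎
    where open ≡-Reasoning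

  𝟙 : Bool → ℚ
  𝟙 b = if b then 1ℚ else 0ℚ

  expect : List X → (X → ℚ) → (m : ℕ) → (Vec X m → ℚ) → ℚ
  expect xs μ m G = sumL (seqs xs m) (λ v → prodV v μ * G v)

  Pr : List X → (X → ℚ) → (m : ℕ) → (Vec X m → Bool) → ℚ
  Pr xs μ m E = expect xs μ m (𝟙 ∘ E)

  Pr-cong : (xs : List X) (μ : X → ℚ) (m : ℕ) {E F : Vec X m → Bool} →
            (∀ v → E v ≡ F v) → Pr xs μ m E ≡ Pr xs μ m F
  Pr-cong xs μ m E≡F = sumL-cong (seqs xs m) (λ v → cong (λ b → prodV v μ * 𝟙 b) (E≡F v))

  expect-cons : (xs : List X) (μ : X → ℚ) (m : ℕ) (G : Vec X (suc m) → ℚ) →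
    expect xs μ (suc m) G ≡ sumL xs (λ x → μ x * expect xs μ m (λ v → G (x ∷ v)))
  expect-cons xs μ m G = trans (sumL-seqs xs m _) (sumL-cong xs λ x →
    trans (sumL-cong (seqs xs m) (λ v → *-assoc (μ x) (prodV v μ) (G (x ∷ v))))
          (sumL-*ˡ (seqs xs m) (μ x) _))

  pushforward : DecidableEquality X → List Y → (Y → ℚ) → (Y → X) → X → ℚ
  pushforward _≟_ ys ν e x = sumL ys (λ y → if does (x ≟ e y) then ν y else 0ℚ)

  pushforward-nonNeg : (_≟_ : DecidableEquality X) (ys : List Y) {ν : Y → ℚ} (e : Y → X) →
    (∀ y → 0ℚ ≤ ν y) → ∀ x → 0ℚ ≤ pushforward _≟_ ys ν e x
  pushforward-nonNeg _≟_ ys {ν} e ν≥0 x = sumL-nonNeg ys term≥0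
    where
    term≥0 : ∀ y → 0ℚ ≤ (if does (x ≟ e y) then ν y else 0ℚ)
    term≥0 y with does (x ≟ e y)
    ... | true  = ν≥0 y
    ... | false = ≤-refl

  if-*ʳ : ∀ b p q → (if b then p else 0ℚ) * q ≡ (if b then p * q else 0ℚ)
  if-*ʳ true  p q = refl
  if-*ʳ false p q = *-zeroˡ q

  module _ (_≟_ : DecidableEquality X) (ys : List Y) (ν : Y → ℚ) (e : Y → X)
           {dom : List X} (unique : Unique dom) (e∈dom : ∀ y → e y ∈ dom) where

    pushforward-sum : (F : X → ℚ) →
      sumL dom (λ x → pushforward _≟_ ys ν e x * F x) ≡ sumL ys (λ y → ν y * F (e y))
    pushforward-sum F = begin
      sumL dom (λ x → pushforward _≟_ ys ν e x * F x)
        ≡⟨ sumL-cong dom (λ x → sym (sumL-*ʳ ys (F x) _)) ⟩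
      sumL dom (λ x → sumL ys (λ y → (if does (x ≟ e y) then ν y else 0ℚ) * F x))
        ≡⟨ sumL-swap dom ys _ ⟩
      sumL ys (λ y → sumL dom (λ x → (if does (x ≟ e y) then ν y else 0ℚ) * F x))
        ≡⟨ sumL-cong ys (λ y → sumL-cong dom (λ x → if-*ʳ (does (x ≟ e y)) (ν y) (F x))) ⟩
      sumL ys (λ y → sumL dom (λ x → if does (x ≟ e y) then ν y * F x else 0ℚ))
        ≡⟨ sumL-cong ys (λ y → sumL-if-≟ _≟_ unique (e∈dom y) (λ x → ν y * F x)) ⟩
      sumL ys (λ y → ν y * F (e y)) ∎
      where open ≡-Reasoning

    pushforward-expect : ∀ m (G : Vec X m → ℚ) →
      expect dom (pushforward _≟_ ys ν e) m G ≡ expect ys ν m (G ∘ Vec.map e)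
    pushforward-expect zero    G = refl
    pushforward-expect (suc m) G = begin
      expect dom μ (suc m) G
        ≡⟨ expect-cons dom μ m G ⟩
      sumL dom (λ x → μ x * expect dom μ m (λ v → G (x ∷ v)))
        ≡⟨ sumL-cong dom (λ x → cong (μ x *_) (pushforward-expect m (λ v → G (x ∷ v)))) ⟩
      sumL dom (λ x → μ x * expect ys ν m (λ u → G (x ∷ Vec.map e u)))
        ≡⟨ pushforward-sum (λ x → expect ys ν m (λ u → G (x ∷ Vec.map e u))) ⟩
      sumL ys (λ y → ν y * expect ys ν m (λ u → G (e y ∷ Vec.map e u)))
        ≡⟨ expect-cons ys ν m (G ∘ Vec.map e) ⟨
      expect ys ν (suc m) (G ∘ Vec.map e) ∎
      where
      open ≡-Reasoning
      μ : X → ℚ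
      μ = pushforward _≟_ ys ν e

  module ProductMeasure {xs : List X} {μ : X → ℚ} (μ≥0 : ∀ x → 0ℚ ≤ μ x) where

    prodV-nonNeg : ∀ {m} (v : Vec X m) → 0ℚ ≤ prodV v μ
    prodV-nonNeg []      = 0≤1
    prodV-nonNeg (x ∷ v) = *-nonNeg (μ≥0 x) (prodV-nonNeg v)

    expect-mono : ∀ m {G H : Vec X m → ℚ} → (∀ v → G v ≤ H v) →
                  expect xs μ m G ≤ expect xs μ m H
    expect-mono m G≤H = sumL-mono (seqs xs m) (λ v → *-monoˡ-≤-0≤ (prodV-nonNeg v) (G≤H v))

    expect-+ : ∀ m (G H : Vec X m → ℚ) →
               expect xs μ m (λ v → G v + H v) ≡ expect xs μ m G + expect xs μ m H
    expect-+ m G H = trans (sumL-cong (seqs xs m) (λ v → *-distribˡ-+ (prodV v μ) (G v) (H v)))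
                           (sumL-+ (seqs xs m) _ _)

    expect-*ˡ : ∀ m r (G : Vec X m → ℚ) →
                expect xs μ m (λ v → r * G v) ≡ r * expect xs μ m G
    expect-*ˡ m r G = trans (sumL-cong (seqs xs m) reorder) (sumL-*ˡ (seqs xs m) r _)
      where
      open +-*-Solver
      reorder : ∀ v → prodV v μ * (r * G v) ≡ r * (prodV v μ * G v)
      reorder v = solve 3 (λ p r g → p :* (r :* g) := r :* (p :* g)) refl (prodV v μ) r (G v)

    sumL-expect : (ys : List Y) → ∀ m (G : Y → Vec X m → ℚ) →
      sumL ys (λ y → expect xs μ m (G y)) ≡ expect xs μ m (λ v → sumL ys (λ y → G y v))
    sumL-expect ys m G = trans (sumL-swap ys (seqs xs m) _)
      (sumL-cong (seqs xs m) (λ v → sumL-*ˡ ys (prodV v μ) (λ y → G y v)))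

    module _ (Σμ≡1 : sumL xs μ ≡ 1ℚ) where

      Pr-true : ∀ m → Pr xs μ m (λ _ → true) ≡ 1ℚ
      Pr-true zero    = refl
      Pr-true (suc m) = begin
        Pr xs μ (suc m) (λ _ → true)
          ≡⟨ expect-cons xs μ m _ ⟩
        sumL xs (λ x → μ x * Pr xs μ m (λ _ → true))
          ≡⟨ sumL-cong xs (λ x → cong (μ x *_) (Pr-true m)) ⟩
        sumL xs (λ x → μ x * 1ℚ)
          ≡⟨ sumL-*ʳ xs 1ℚ μ ⟩
        sumL xs μ * 1ℚ
          ≡⟨ trans (*-identityʳ _) Σμ≡1 ⟩
        1ℚ ∎
        where open ≡-Reasoning

      -- Condition on the first sample: either it is a hit and t of the other m samples are
      -- hits, or it is not and t + 1 of them are.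
      count-tail : {P : X → Set} (P? : Decidable P) {q : ℚ} → 0ℚ ≤ q →
                   sumL xs (λ x → if does (P? x) then μ x else 0ℚ) ≤ q →
                   ∀ m t → Pr xs μ m (λ v → t ≤ᵇ count P? v) ≤ fromℕ (m ℕ.^ t) * q ^ℚ t
      count-tail P? {q} 0≤q mass≤q zero    zero    = ≤-refl
      count-tail P? {q} 0≤q mass≤q zero    (suc t) = ≤-reflexive (sym (*-zeroˡ (q ^ℚ suc t)))
      count-tail P? {q} 0≤q mass≤q (suc m) zero    = ≤-reflexive (Pr-true (suc m))
      count-tail P? {q} 0≤q mass≤q (suc m) (suc t) = begin
        Pr xs μ (suc m) (λ v → suc t ≤ᵇ count P? v)
          ≡⟨ expect-cons xs μ m _ ⟩
        sumL xs (λ x → μ x * Pr xs μ m (λ v → suc t ≤ᵇ count P? (x ∷ v)))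
          ≤⟨ sumL-mono xs (λ x → *-monoˡ-≤-0≤ (μ≥0 x) (first-sample x)) ⟩
        sumL xs (λ x → μ x * ((if does (P? x) then B₁ else 0ℚ) + B₂))
          ≡⟨ sumL-cong xs split ⟩
        sumL xs (λ x → (if does (P? x) then μ x else 0ℚ) * B₁ + μ x * B₂)
          ≡⟨ trans (sumL-+ xs _ _) (cong₂ _+_ (sumL-*ʳ xs B₁ _) (sumL-*ʳ xs B₂ μ)) ⟩
        sumL xs (λ x → if does (P? x) then μ x else 0ℚ) * B₁ + sumL xs μ * B₂
          ≤⟨ +-mono-≤ (*-monoʳ-≤-0≤ (B-nonNeg t) mass≤q) (≤-reflexive (cong (_* B₂) Σμ≡1)) ⟩
        q * B₁ + 1ℚ * B₂
          ≡⟨ solve 4 (λ q a b c → q :* (a :* c) :+ con 1ℚ :* (b :* (q :* c))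
                                  := (a :+ b) :* (q :* c))
                     refl q (fromℕ (m ℕ.^ t)) (fromℕ (m ℕ.^ suc t)) (q ^ℚ t) ⟩
        (fromℕ (m ℕ.^ t) + fromℕ (m ℕ.^ suc t)) * q ^ℚ suc t
          ≡⟨ cong (_* q ^ℚ suc t) (fromℕ-+ (m ℕ.^ t) (m ℕ.^ suc t)) ⟨
        fromℕ (m ℕ.^ t ℕ.+ m ℕ.^ suc t) * q ^ℚ suc t
          ≤⟨ *-monoʳ-≤-0≤ (^ℚ-nonNeg 0≤q (suc t)) (fromℕ-mono-≤ (m^t+m^[1+t]≤[1+m]^[1+t] m t)) ⟩
        fromℕ (suc m ℕ.^ suc t) * q ^ℚ suc t ∎
        where
        open ≤-Reasoning
        open +-*-Solver
        B-nonNeg : ∀ k → 0ℚ ≤ fromℕ (m ℕ.^ k) * q ^ℚ k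
        B-nonNeg k = *-nonNeg (fromℕ-nonNeg (m ℕ.^ k)) (^ℚ-nonNeg 0≤q k)
        B₁ B₂ : ℚ
        B₁ = fromℕ (m ℕ.^ t) * q ^ℚ t
        B₂ = fromℕ (m ℕ.^ suc t) * q ^ℚ suc t
        first-sample : ∀ x → Pr xs μ m (λ v → suc t ≤ᵇ count P? (x ∷ v)) ≤
                             (if does (P? x) then B₁ else 0ℚ) + B₂
        first-sample x with does (P? x)
        ... | true  = ≤-trans (≤-reflexive (Pr-cong xs μ m (λ v → suc-≤ᵇ-suc t (count P? v))))
                              (≤-trans (count-tail P? 0≤q mass≤q m t) (p≤p+q (B-nonNeg (suc t))))
        ... | false = ≤-trans (count-tail P? 0≤q mass≤q m (suc t))
                              (≤-reflexive (sym (+-identityˡ B₂)))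
        split : ∀ x → μ x * ((if does (P? x) then B₁ else 0ℚ) + B₂) ≡
                      (if does (P? x) then μ x else 0ℚ) * B₁ + μ x * B₂
        split x with does (P? x)
        ... | true  = *-distribˡ-+ (μ x) B₁ B₂
        ... | false = trans (cong (μ x *_) (+-identityˡ B₂))
                            (sym (trans (cong (_+ μ x * B₂) (*-zeroˡ B₁)) (+-identityˡ _)))

  telescope : (Ψ : ℕ → ℚ) (δ : ℚ) (n : ℕ) → (∀ k → k ℕ.< n → Ψ (suc k) ≤ Ψ k + δ) →
              Ψ n ≤ Ψ 0 + fromℕ n * δ
  telescope Ψ δ zero    step =
    ≤-reflexive (sym (trans (cong (λ s → Ψ 0 + s) (*-zeroˡ δ)) (+-identityʳ _)))
  telescope Ψ δ (suc n) step = begin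
    Ψ (suc n)               ≤⟨ step n (ℕ.n<1+n n) ⟩
    Ψ n + δ                 ≤⟨ +-monoˡ-≤ δ (telescope Ψ δ n (λ k → step k ∘ ℕ.m<n⇒m<1+n)) ⟩
    (Ψ 0 + fromℕ n * δ) + δ ≡⟨ solve 3 (λ a k d → (a :+ k :* d) :+ d := a :+ (con 1ℚ :+ k) :* d)
                                       refl (Ψ 0) (fromℕ n) δ ⟩
    Ψ 0 + fromℕ (suc n) * δ ∎
    where
    open ≤-Reasoning
    open +-*-Solver

  n*m³q³<1/3 : ∀ {q} n m → fromℕ n * q ≡ 1ℚ → 3 ℕ.* m ℕ.^ 3 ℕ.< n ℕ.^ 2 →
               fromℕ n * (fromℕ (m ℕ.^ 3) * q ^ℚ 3) < + 1 / 3
  n*m³q³<1/3 {q} n m nq≡1 3m³<n² =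
    *-cancelʳ-<-nonNeg (n′ * n′) {{nonNegative n′²≥0}} (begin-strict
      n′ * (m³ * q ^ℚ 3) * (n′ * n′)
        ≡⟨ solve 3 (λ u y q → u :* (y :* (q :* (q :* (q :* con 1ℚ)))) :* (u :* u)
                               := (q :* u) :* ((q :* u) :* ((q :* u) :* y))) refl n′ m³ q ⟩
      (q * n′) * ((q * n′) * ((q * n′) * m³))
        ≡⟨ cong (λ z → z * (z * (z * m³))) (trans (*-comm q n′) nq≡1) ⟩
      1ℚ * (1ℚ * (1ℚ * m³))
        ≡⟨ solve 1 (λ y → con 1ℚ :* (con 1ℚ :* (con 1ℚ :* y)) := con (+ 1 / 3) :* (con (fromℕ 3) :* y))
                   refl m³ ⟩
      + 1 / 3 * (fromℕ 3 * m³)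
        ≡⟨ cong (+ 1 / 3 *_) (fromℕ-* 3 (m ℕ.^ 3)) ⟨
      + 1 / 3 * fromℕ (3 ℕ.* m ℕ.^ 3)
        <⟨ *-monoʳ-<-pos (+ 1 / 3) (fromℕ-mono-< 3m³<n²) ⟩
      + 1 / 3 * fromℕ (n ℕ.^ 2)
        ≡⟨ cong (+ 1 / 3 *_) n²≡n′*n′ ⟩
      + 1 / 3 * (n′ * n′) ∎)
    where
    open ≤-Reasoning
    open +-*-Solver
    n′ m³ : ℚ
    n′ = fromℕ n
    m³ = fromℕ (m ℕ.^ 3)
    n′²≥0 : 0ℚ ≤ n′ * n′
    n′²≥0 = *-nonNeg (fromℕ-nonNeg n) (fromℕ-nonNeg n)
    n²≡n′*n′ : fromℕ (n ℕ.^ 2) ≡ n′ * n′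
    n²≡n′*n′ = trans (fromℕ-* n (n ℕ.* 1)) (cong (n′ *_) (trans (fromℕ-* n 1) (*-identityʳ n′)))

module K4 where

  open import Data.Bool using (Bool; true; false; not; _∧_)
  import Data.Bool.Properties as Bool
  open import Data.Fin as Fin using (Fin; zero; suc; #_)
  open import Data.Fin.Properties using (_≟_; all?; any?)
  open import Data.List using (List; []; _∷_; cartesianProduct; allFin; length)
  open import Data.List.Membership.Propositional using (_∉_)
  open import Data.List.Relation.Unary.Any using (here; there)
  open import Data.Product using (_×_; _,_; proj₁; proj₂; ∃)
  open import Data.Rational using (ℚ; 0ℚ; _≤_)
  open import Data.Rational.Properties using (_≤?_)
  open import Data.Rational.Solver using (module +-*-Solver)
  open import Data.Vec as Vec using (Vec; []; _∷_; count)
  open import Data.Vec.Relation.Unary.All as VecAll using ([]; _∷_)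
  open import Function using (_∘_)
  open import Relation.Binary.PropositionalEquality using (_≡_; _≢_; refl; sym; subst)
  open import Relation.Nullary using (Dec; yes; no; does; ¬?; _×-dec_; _→-dec_; contradiction)
  open import Relation.Nullary.Decidable using (from-yes)
  open import Relation.Unary using (Decidable)

  open FiniteProbability using (fromℕ)

  clique : {V : Set} → (V → Bool) → V × V → Bool
  clique S (i , j) = S i ∧ S j

  -- The edge (j , b) of K4 is side b of the perfect matching j, and swapAlong j exchanges the
  -- endpoints of both edges of that matching.
  K4Edge : Set
  K4Edge = Fin 3 × Fin 2

  k4Edges : List K4Edge
  k4Edges = cartesianProduct (allFin 3) (allFin 2)

  endpoints : K4Edge → Fin 4 × Fin 4
  endpoints (j , b) = Vec.lookup (Vec.lookup matchings j) b
    where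
    matchings : Vec (Vec (Fin 4 × Fin 4) 2) 3
    matchings = ((# 0 , # 1) ∷ (# 2 , # 3) ∷ [])
              ∷ ((# 0 , # 2) ∷ (# 1 , # 3) ∷ [])
              ∷ ((# 0 , # 3) ∷ (# 1 , # 2) ∷ [])
              ∷ []

  swapAlong : Fin 3 → Fin 4 → Fin 4
  swapAlong j = Vec.lookup (Vec.lookup partners j)
    where
    partners : Vec (Vec (Fin 4) 4) 3
    partners = (# 1 ∷ # 0 ∷ # 3 ∷ # 2 ∷ [])
             ∷ (# 2 ∷ # 3 ∷ # 0 ∷ # 1 ∷ [])
             ∷ (# 3 ∷ # 2 ∷ # 1 ∷ # 0 ∷ [])
             ∷ []

  avoids : Fin 4 → Fin 4 → Bool
  avoids x r = not (does (r ≟ x))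

  triangleOpposite : Fin 4 → K4Edge → Bool
  triangleOpposite x e = clique (avoids x) (endpoints e)

  starMismatches : Fin 4 → (Fin 4 → Bool) → ℚ
  starMismatches x B = sumL k4Edges (λ e → neq (not (triangleOpposite x e)) (clique B (endpoints e)))

  endpoints-< : ∀ e → proj₁ (endpoints e) Fin.< proj₂ (endpoints e)
  endpoints-< (j , b) = from-yes decision j b
    where
    decision : Dec (∀ j b → proj₁ (endpoints (j , b)) Fin.< proj₂ (endpoints (j , b)))
    decision = all? λ j → all? λ b → proj₁ (endpoints (j , b)) Fin.<? proj₂ (endpoints (j , b))

  -- swapAlong j maps every edge outside the matching j to the complementary edge.
  triangleOpposite-swapAlong : ∀ j e x → proj₁ e ≢ j →
    triangleOpposite x e ≡ not (triangleOpposite (swapAlong j x) e)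
  triangleOpposite-swapAlong j (j′ , b) = from-yes
    (all? λ j → all? λ j′ → all? λ b → all? λ x → ¬? (j′ ≟ j) →-dec
       (triangleOpposite x (j′ , b) Bool.≟ not (triangleOpposite (swapAlong j x) (j′ , b))))
    j j′ b

  sumL-swapAlong : ∀ j (h : Fin 4 → ℚ) → sumL (allFin 4) (h ∘ swapAlong j) ≡ sumL (allFin 4) h
  sumL-swapAlong zero             h =
    solve 4 (λ a b c d → b :+ (a :+ (d :+ (c :+ con 0ℚ))) := a :+ (b :+ (c :+ (d :+ con 0ℚ))))
      refl (h (# 0)) (h (# 1)) (h (# 2)) (h (# 3))
    where open +-*-Solver
  sumL-swapAlong (suc zero)       h =
    solve 4 (λ a b c d → c :+ (d :+ (a :+ (b :+ con 0ℚ))) := a :+ (b :+ (c :+ (d :+ con 0ℚ))))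
      refl (h (# 0)) (h (# 1)) (h (# 2)) (h (# 3))
    where open +-*-Solver
  sumL-swapAlong (suc (suc zero)) h =
    solve 4 (λ a b c d → d :+ (c :+ (b :+ (a :+ con 0ℚ))) := a :+ (b :+ (c :+ (d :+ con 0ℚ))))
      refl (h (# 0)) (h (# 1)) (h (# 2)) (h (# 3))
    where open +-*-Solver

  ∀-Bool? : {P : Bool → Set} → Decidable P → Dec (∀ b → P b)
  ∀-Bool? P? with P? true | P? false
  ... | yes t | yes f = yes λ { true → t ; false → f }
  ... | no ¬t | _     = no λ h → ¬t (h true)
  ... | yes _ | no ¬f = no λ h → ¬f (h false)

  -- B enters only through its four values, so it ranges over Boolean vectors of length 4.
  star-far-from-cliques : ∀ x (B : Fin 4 → Bool) → fromℕ 2 ≤ starMismatches x B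
  star-far-from-cliques x B = from-yes
    (all? λ x → ∀-Bool? λ b₀ → ∀-Bool? λ b₁ → ∀-Bool? λ b₂ → ∀-Bool? λ b₃ →
       fromℕ 2 ≤? starMismatches x (Vec.lookup (b₀ ∷ b₁ ∷ b₂ ∷ b₃ ∷ [])))
    x (B (# 0)) (B (# 1)) (B (# 2)) (B (# 3))

  ∃-≢₂ : (a b : Fin 3) → ∃ λ j → j ≢ a × j ≢ b
  ∃-≢₂ a b = from-yes decision a b
    where
    decision : Dec (∀ (a b : Fin 3) → ∃ λ j → j ≢ a × j ≢ b)
    decision = all? λ a → all? λ b → any? λ j → ¬? (j ≟ a) ×-dec ¬? (j ≟ b)

  ∃-∉ : (as : List (Fin 3)) → length as ℕ.≤ 2 → ∃ λ j → j ∉ as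
  ∃-∉ []           _ = zero , λ ()
  ∃-∉ (a ∷ [])     _ with ∃-≢₂ a a
  ... | j , j≢a , _   = j , λ { (here j≡a) → j≢a j≡a }
  ∃-∉ (a ∷ b ∷ []) _ with ∃-≢₂ a b
  ... | j , j≢a , j≢b = j , λ { (here j≡a) → j≢a j≡a ; (there (here j≡b)) → j≢b j≡b }
  ∃-∉ (_ ∷ _ ∷ _ ∷ _) (ℕ.s≤s (ℕ.s≤s ()))

  module _ {X : Set} {P : X → Set} (P? : Decidable P) (matching : X → Fin 3) where

    private
      unused-matching-avoiding : ∀ {m} (u : Vec X m) (as : List (Fin 3)) → length as ℕ.+ count P? u ℕ.≤ 2 →
                                 ∃ λ j → j ∉ as × VecAll.All (λ y → P y → matching y ≢ j) u
      unused-matching-avoiding [] as h with ∃-∉ as (subst (ℕ._≤ 2) (ℕ.+-identityʳ (length as)) h)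
      ... | j , j∉as = j , j∉as , []
      unused-matching-avoiding (y ∷ u) as h with P? y
      ... | yes _ with unused-matching-avoiding u (matching y ∷ as)
                         (subst (ℕ._≤ 2) (ℕ.+-suc (length as) (count P? u)) h)
      ...   | j , j∉ , rest = j , j∉ ∘ there , (λ _ y∈j → j∉ (here (sym y∈j))) ∷ rest
      unused-matching-avoiding (y ∷ u) as h | no ¬Py with unused-matching-avoiding u as h
      ...   | j , j∉ , rest = j , j∉ , (λ Py → contradiction Py ¬Py) ∷ rest

    unused-matching : ∀ {m} (u : Vec X m) → count P? u ℕ.≤ 2 →
                      ∃ λ j → VecAll.All (λ y → P y → matching y ≢ j) u
    unused-matching u h with unused-matching-avoiding u [] h
    ... | j , _ , avoid = j , avoid

module HardInstances (n : ℕ) {{_ : ℕ.NonZero n}} where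

  open import Data.Bool using (Bool; true; false; not; _∧_; _xor_; if_then_else_)
  open import Data.Empty using (⊥)
  open import Data.Fin as Fin using (Fin; toℕ; combine; remQuot; splitAt; _↑ˡ_)
  open import Data.Fin.Properties
    using (_≟_; remQuot-combine; splitAt-↑ˡ; combine-monoˡ-<; toℕ-↑ˡ; toℕ<n; toℕ-injective; toℕ-fromℕ<)
  open import Data.Integer using (+_)
  open import Data.List using (List; cartesianProduct; allFin; length)
  open import Data.List.Membership.Propositional using (_∈_)
  open import Data.List.Membership.Propositional.Properties using (∈-filter⁺; ∈-cartesianProduct⁺; ∈-allFin)
  open import Data.List.Relation.Unary.Unique.Propositional using (Unique)
  open import Data.List.Relation.Unary.Unique.Propositional.Properties
    using (filter⁺; cartesianProduct⁺; allFin⁺)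
  open import Data.Product using (_×_; _,_; proj₁; proj₂)
  open import Data.Product.Properties using (≡-dec)
  open import Data.Rational hiding (_≤ᵇ_; _≟_)
  open import Data.Rational.Properties hiding (_≟_)
  open import Data.Rational.Solver using (module +-*-Solver)
  open import Data.Sum using (_⊎_; inj₁; [_,_]′)
  open import Data.Vec as Vec using (Vec; []; _∷_; lookup; _[_]≔_; count)
  open import Data.Vec.Properties using (lookup∘update; lookup∘update′)
  open import Data.Vec.Relation.Unary.All as VecAll using ([]; _∷_)
  open import Function using (_∘_)
  open import Relation.Binary.Definitions using (DecidableEquality)
  open import Relation.Binary.PropositionalEquality
  open import Relation.Nullary using (does; yes; no; ¬_)
  open import Relation.Nullary.Decidable using (dec-true; dec-false)

  open import Algebra.Definitions.RawSemiring +-*-rawSemiring using () renaming (_^_ to _^ℚ_)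

  open FiniteProbability
  open K4

  N : ℕ
  N = 6 ℕ.* n

  -- Vertex combine ρ g of [6n] is row ρ of gadget g; rows 0–3 carry the K4, rows 4 and 5 are unused.
  vertex : Fin n → Fin 4 → Fin N
  vertex g r = combine (r ↑ˡ 2) g

  gadget : Fin N → Fin n
  gadget i = proj₂ (remQuot {6} n i)

  row : Fin N → Fin 4 ⊎ Fin 2
  row i = splitAt 4 (proj₁ (remQuot {6} n i))

  gadget-vertex : ∀ g r → gadget (vertex g r) ≡ g
  gadget-vertex g r = cong proj₂ (remQuot-combine {6} {n} (r ↑ˡ 2) g)

  row-vertex : ∀ g r → row (vertex g r) ≡ inj₁ r
  row-vertex g r =
    trans (cong (λ p → splitAt 4 (proj₁ p)) (remQuot-combine {6} {n} (r ↑ˡ 2) g)) (splitAt-↑ˡ 4 r 2)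

  GadgetEdge : Set
  GadgetEdge = Fin n × K4Edge

  gadgetEdges : List GadgetEdge
  gadgetEdges = cartesianProduct (allFin n) k4Edges

  embed : GadgetEdge → Pair N
  embed (g , e) = vertex g (proj₁ (endpoints e)) , vertex g (proj₂ (endpoints e))

  embed∈edges : ∀ y → embed y ∈ edges N
  embed∈edges (g , e) = ∈-filter⁺ _ (∈-cartesianProduct⁺ (∈-allFin _) (∈-allFin _))
    (combine-monoˡ-< g g (subst₂ ℕ._<_ (sym (toℕ-↑ˡ _ 2)) (sym (toℕ-↑ˡ _ 2)) (endpoints-< e)))

  edges-unique : Unique (edges N)
  edges-unique = filter⁺ _ (cartesianProduct⁺ (allFin⁺ _) (allFin⁺ _))

  _≟ₚ_ : DecidableEquality (Pair N)
  _≟ₚ_ = ≡-dec _≟_ _≟_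

  N>0 : 0ℚ < fromℕ N
  N>0 = fromℕ-mono-< (ℕ.>-nonZero⁻¹ N {{ℕ.m*n≢0 6 n}})

  instance
    N≢0 : NonZero (fromℕ N)
    N≢0 = pos⇒nonZero (fromℕ N) {{positive N>0}}

  w : ℚ
  w = 1/ fromℕ N

  w≥0 : 0ℚ ≤ w
  w≥0 = <⇒≤ (positive⁻¹ w {{1/pos⇒pos (fromℕ N) {{positive N>0}}}})

  q : ℚ
  q = fromℕ 6 * w

  n*q≡1 : fromℕ n * q ≡ 1ℚ
  n*q≡1 = begin
    fromℕ n * (fromℕ 6 * w) ≡⟨ *-assoc (fromℕ n) (fromℕ 6) w ⟨
    fromℕ n * fromℕ 6 * w   ≡⟨ cong (_* w) (trans (*-comm (fromℕ n) (fromℕ 6)) (sym (fromℕ-* 6 n))) ⟩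
    fromℕ N * w             ≡⟨ *-inverseʳ (fromℕ N) ⟩
    1ℚ                      ∎
    where open ≡-Reasoning

  ν : GadgetEdge → ℚ
  ν _ = w

  ν-sum : sumL gadgetEdges ν ≡ 1ℚ
  ν-sum = begin
    sumL gadgetEdges ν                             ≡⟨ sumL-cartesianProduct (allFin n) k4Edges ν ⟩
    sumL (allFin n) (λ _ → sumL k4Edges (λ _ → w)) ≡⟨ sumL-cong (allFin n) (λ _ → sumL-const k4Edges w) ⟩
    sumL (allFin n) (λ _ → q)                      ≡⟨ sumL-allFin-const n q ⟩
    fromℕ n * q                                    ≡⟨ n*q≡1 ⟩
    1ℚ                                             ∎
    where open ≡-Reasoning

  gadget-mass : ∀ k → sumL gadgetEdges (λ y → if does (proj₁ y ≟ k) then w else 0ℚ) ≡ q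
  gadget-mass k = begin
    sumL gadgetEdges (λ y → if does (proj₁ y ≟ k) then w else 0ℚ)
      ≡⟨ sumL-cartesianProduct (allFin n) k4Edges _ ⟩
    sumL (allFin n) (λ g → sumL k4Edges (λ _ → if does (g ≟ k) then w else 0ℚ))
      ≡⟨ sumL-cong (allFin n) (λ g → one-gadget (does (g ≟ k))) ⟩
    sumL (allFin n) (λ g → if does (g ≟ k) then q else 0ℚ)
      ≡⟨ sumL-if-≟ _≟_ (allFin⁺ n) (∈-allFin k) (λ _ → q) ⟩
    q ∎
    where
    open ≡-Reasoning
    one-gadget : ∀ b → sumL k4Edges (λ _ → if b then w else 0ℚ) ≡ (if b then q else 0ℚ)
    one-gadget true  = sumL-const k4Edges w
    one-gadget false = sumL-zero k4Edges

  μ : Pair N → ℚ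
  μ = pushforward _≟ₚ_ gadgetEdges ν embed

  μ-sum : (F : Pair N → ℚ) →
          sumL (edges N) (λ x → μ x * F x) ≡ sumL gadgetEdges (λ y → w * F (embed y))
  μ-sum = pushforward-sum _≟ₚ_ gadgetEdges ν embed edges-unique embed∈edges

  μ-isDist : IsDist (edges N) μ
  μ-isDist = pushforward-nonNeg _≟ₚ_ gadgetEdges embed (λ _ → w≥0) , (begin
    sumL (edges N) μ                ≡⟨ sumL-cong (edges N) (λ x → sym (*-identityʳ (μ x))) ⟩
    sumL (edges N) (λ x → μ x * 1ℚ) ≡⟨ μ-sum (λ _ → 1ℚ) ⟩
    sumL gadgetEdges (λ _ → w * 1ℚ) ≡⟨ sumL-cong gadgetEdges (λ _ → *-identityʳ w) ⟩
    sumL gadgetEdges ν              ≡⟨ ν-sum ⟩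
    1ℚ                              ∎)
    where open ≡-Reasoning

  Config : Set
  Config = Vec (Fin 4) n

  configs : List Config
  configs = seqs (allFin 4) n

  #configs : ℚ
  #configs = fromℕ (length configs)

  #configs>0 : 0ℚ < #configs
  #configs>0 = fromℕ-mono-< (seqs-nonempty _ n)

  inTriangle : Config → Fin N → Bool
  inTriangle c i = [ avoids (lookup c (gadget i)) , (λ _ → false) ]′ (row i)

  -- Gadgets g with k ≤ g are flipped from the triangle opposite c g to the star at c g.
  hybrid : ℕ → Config → Pair N → Bool
  hybrid k c p = (k ≤ᵇ toℕ (gadget (proj₁ p))) xor clique (inTriangle c) p

  inTriangle-vertex : ∀ c g r → inTriangle c (vertex g r) ≡ avoids (lookup c g) r
  inTriangle-vertex c g r rewrite row-vertex g r | gadget-vertex g r = refl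

  hybrid-embed : ∀ k c g e →
                 hybrid k c (embed (g , e)) ≡ (k ≤ᵇ toℕ g) xor triangleOpposite (lookup c g) e
  hybrid-embed k c g e = cong₂ _xor_
    (cong (λ g′ → k ≤ᵇ toℕ g′) (gadget-vertex g (proj₁ (endpoints e))))
    (cong₂ _∧_ (inTriangle-vertex c g (proj₁ (endpoints e))) (inTriangle-vertex c g (proj₂ (endpoints e))))

  hybrid-n-isClique : ∀ c → IsClique N (hybrid n c)
  hybrid-n-isClique c = inTriangle c , λ p _ →
    cong (_xor clique (inTriangle c) p) (dec-false (n ℕ.≤? toℕ (gadget (proj₁ p))) (ℕ.<⇒≱ (toℕ<n _)))

  hybrid-0-far : ∀ c h → IsClique N h → + 1 / 4 ≤ dist (edges N) μ (hybrid 0 c) h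
  hybrid-0-far c h (S , h≡S) = begin
    + 1 / 4
      ≤⟨ ≤ᵇ⇒≤ _ ⟩
    + 1 / 3
      ≡⟨ w*n*2≡1/3 ⟨
    w * (fromℕ n * fromℕ 2)
      ≡⟨ cong (w *_) (sumL-allFin-const n (fromℕ 2)) ⟨
    w * sumL (allFin n) (λ _ → fromℕ 2)
      ≤⟨ *-monoˡ-≤-0≤ w≥0 (sumL-mono (allFin n) gadget-far) ⟩
    w * sumL (allFin n) (λ g → starMismatches (lookup c g) (S ∘ vertex g))
      ≡⟨ cong (w *_) (sumL-cartesianProduct (allFin n) k4Edges mismatch) ⟨
    w * sumL gadgetEdges mismatch
      ≡⟨ sumL-*ˡ gadgetEdges w mismatch ⟨
    sumL gadgetEdges (λ y → w * mismatch y)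
      ≡⟨ sumL-cong gadgetEdges (λ y → cong (w *_) (mismatch-embed y)) ⟩
    sumL gadgetEdges (λ y → w * neq (hybrid 0 c (embed y)) (h (embed y)))
      ≡⟨ μ-sum (λ x → neq (hybrid 0 c x) (h x)) ⟨
    dist (edges N) μ (hybrid 0 c) h ∎
    where
    open ≤-Reasoning
    mismatch : GadgetEdge → ℚ
    mismatch (g , e) = neq (not (triangleOpposite (lookup c g) e)) (clique (S ∘ vertex g) (endpoints e))
    mismatch-embed : ∀ y → mismatch y ≡ neq (hybrid 0 c (embed y)) (h (embed y))
    mismatch-embed (g , e) =
      sym (cong₂ neq (hybrid-embed 0 c g e) (h≡S (embed (g , e)) (embed∈edges (g , e))))
    gadget-far : ∀ g → fromℕ 2 ≤ starMismatches (lookup c g) (S ∘ vertex g)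
    gadget-far g = star-far-from-cliques (lookup c g) (S ∘ vertex g)
    w*n*2≡1/3 : w * (fromℕ n * fromℕ 2) ≡ + 1 / 3
    w*n*2≡1/3 = begin-equality
      w * (fromℕ n * (fromℕ 6 * (+ 1 / 3)))
        ≡⟨ solve 4 (λ w n s t → w :* (n :* (s :* t)) := (n :* (s :* w)) :* t)
                   refl w (fromℕ n) (fromℕ 6) (+ 1 / 3) ⟩
      fromℕ n * q * (+ 1 / 3)
        ≡⟨ cong (_* (+ 1 / 3)) n*q≡1 ⟩
      1ℚ * (+ 1 / 3)
        ≡⟨ *-identityˡ _ ⟩
      + 1 / 3 ∎
      where open +-*-Solver

  withTriangle withStar : Config → Fin n → Fin 4 → Pair N → Bool
  withTriangle c kk x = hybrid (suc (toℕ kk)) (c [ kk ]≔ x)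
  withStar     c kk x = hybrid (toℕ kk) (c [ kk ]≔ x)

  withTriangle-swapAlong : ∀ c kk j x (y : GadgetEdge) → (proj₁ y ≡ kk → proj₁ (proj₂ y) ≢ j) →
                           withTriangle c kk x (embed y) ≡ withStar c kk (swapAlong j x) (embed y)
  withTriangle-swapAlong c kk j x (g , e) outside-j with g ≟ kk
  ... | yes refl = begin
    withTriangle c g x (embed (g , e))
      ≡⟨ hybrid-embed (suc k) (c [ g ]≔ x) g e ⟩
    (suc k ≤ᵇ k) xor triangleOpposite (lookup (c [ g ]≔ x) g) e
      ≡⟨ cong₂ _xor_ (dec-false (suc k ℕ.≤? k) (ℕ.n≮n k))
                     (cong (λ z → triangleOpposite z e) (lookup∘update g c x)) ⟩
    triangleOpposite x e
      ≡⟨ triangleOpposite-swapAlong j e x (outside-j refl) ⟩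
    true xor triangleOpposite (swapAlong j x) e
      ≡⟨ cong₂ _xor_ (dec-true (k ℕ.≤? k) ℕ.≤-refl)
                     (cong (λ z → triangleOpposite z e) (lookup∘update g c (swapAlong j x))) ⟨
    (k ≤ᵇ k) xor triangleOpposite (lookup (c [ g ]≔ swapAlong j x) g) e
      ≡⟨ hybrid-embed k (c [ g ]≔ swapAlong j x) g e ⟨
    withStar c g (swapAlong j x) (embed (g , e)) ∎
    where
    open ≡-Reasoning
    k : ℕ
    k = toℕ g
  ... | no g≢kk = begin
    withTriangle c kk x (embed (g , e))
      ≡⟨ hybrid-embed (suc k) (c [ kk ]≔ x) g e ⟩
    (suc k ≤ᵇ toℕ g) xor triangleOpposite (lookup (c [ kk ]≔ x) g) e
      ≡⟨ cong₂ _xor_ (suc-≤ᵇ-≢ (λ k≡g → g≢kk (toℕ-injective (sym k≡g))))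
                     (cong (λ z → triangleOpposite z e) (lookup∘update′ g≢kk c x)) ⟩
    (k ≤ᵇ toℕ g) xor triangleOpposite (lookup c g) e
      ≡⟨ cong (λ z → (k ≤ᵇ toℕ g) xor triangleOpposite z e)
              (lookup∘update′ g≢kk c (swapAlong j x)) ⟨
    (k ≤ᵇ toℕ g) xor triangleOpposite (lookup (c [ kk ]≔ swapAlong j x) g) e
      ≡⟨ hybrid-embed k (c [ kk ]≔ swapAlong j x) g e ⟨
    withStar c kk (swapAlong j x) (embed (g , e)) ∎
    where
    open ≡-Reasoning
    k : ℕ
    k = toℕ kk

  open ProductMeasure {xs = gadgetEdges} {μ = ν} (λ _ → w≥0)

  module _ {m : ℕ} (A : Algorithm (Pair N) m) (A-valid : ValidAlg A) where

    acceptance : (Pair N → Bool) → ℚ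
    acceptance f = accProb (edges N) μ f A

    verdict : Vec GadgetEdge m → (Pair N → Bool) → ℚ
    verdict u f = A (Vec.map (λ x → x , f x) (Vec.map embed u))

    acceptance-gadgetEdges : ∀ f → acceptance f ≡ expect gadgetEdges ν m (λ u → verdict u f)
    acceptance-gadgetEdges f = pushforward-expect _≟ₚ_ gadgetEdges ν embed edges-unique embed∈edges m
                                                  (λ v → A (Vec.map (λ x → x , f x) v))

    verdict-bounds : ∀ u f → 0ℚ ≤ verdict u f × verdict u f ≤ 1ℚ
    verdict-bounds u f = A-valid (Vec.map (λ x → x , f x) (Vec.map embed u))

    verdict-cong : ∀ u (f f′ : Pair N → Bool) →
                   VecAll.All (λ y → f (embed y) ≡ f′ (embed y)) u → verdict u f ≡ verdict u f′
    verdict-cong u f f′ agree = cong A (labels-agree u agree)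
      where
      labels-agree : ∀ {k} (u : Vec GadgetEdge k) → VecAll.All (λ y → f (embed y) ≡ f′ (embed y)) u →
        Vec.map (λ x → x , f x) (Vec.map embed u) ≡ Vec.map (λ x → x , f′ x) (Vec.map embed u)
      labels-agree []      []              = refl
      labels-agree (y ∷ u) (fy≡f′y ∷ rest) =
        cong₂ _∷_ (cong (embed y ,_) fy≡f′y) (labels-agree u rest)

    heavy : Fin n → Vec GadgetEdge m → Bool
    heavy kk u = 3 ≤ᵇ count (λ y → proj₁ y ≟ kk) u

    pHeavy : Fin n → ℚ
    pHeavy kk = Pr gadgetEdges ν m (heavy kk)

    -- When gadget kk holds at most two samples, some matching j of it is unseen, and on the seen
    -- edges the triangle opposite x looks like the star at swapAlong j x.
    swap-step : ∀ c kk u →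
      sumL (allFin 4) (λ x → verdict u (withTriangle c kk x))
        ≤ sumL (allFin 4) (λ x → verdict u (withStar c kk x)) + fromℕ 4 * 𝟙 (heavy kk u)
    swap-step c kk u with heavy kk u in heavy≡
    ... | true = begin
      sumL (allFin 4) (λ x → verdict u (withTriangle c kk x))
        ≤⟨ sumL-mono (allFin 4) (λ x → proj₂ (verdict-bounds u (withTriangle c kk x))) ⟩
      sumL (allFin 4) (λ _ → 1ℚ)
        ≡⟨ sumL-allFin-const 4 1ℚ ⟩
      fromℕ 4 * 1ℚ
        ≤⟨ p≤q+p (sumL-nonNeg (allFin 4) (λ x → proj₁ (verdict-bounds u (withStar c kk x)))) ⟩
      sumL (allFin 4) (λ x → verdict u (withStar c kk x)) + fromℕ 4 * 1ℚ ∎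
      where open ≤-Reasoning
    ... | false with unused-matching (λ y → proj₁ y ≟ kk) (λ y → proj₁ (proj₂ y)) u
                       (ℕ.≤-pred (≤ᵇ≡false⇒> heavy≡))
    ...   | j , outside-j = begin
      sumL (allFin 4) (λ x → verdict u (withTriangle c kk x))
        ≡⟨ sumL-cong (allFin 4) (λ x → verdict-cong u (withTriangle c kk x) (withStar c kk (swapAlong j x))
                                         (VecAll.map (λ {y} → withTriangle-swapAlong c kk j x y) outside-j)) ⟩
      sumL (allFin 4) (λ x → verdict u (withStar c kk (swapAlong j x)))
        ≡⟨ sumL-swapAlong j (λ x → verdict u (withStar c kk x)) ⟩
      sumL (allFin 4) (λ x → verdict u (withStar c kk x))
        ≤⟨ p≤p+q (≤-reflexive (sym (*-zeroʳ (fromℕ 4)))) ⟩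
      sumL (allFin 4) (λ x → verdict u (withStar c kk x)) + fromℕ 4 * 0ℚ ∎
      where open ≤-Reasoning

    config-step : ∀ c kk → sumL (allFin 4) (λ x → acceptance (withTriangle c kk x))
                             ≤ sumL (allFin 4) (λ x → acceptance (withStar c kk x)) + fromℕ 4 * pHeavy kk
    config-step c kk = begin
      sumL (allFin 4) (λ x → acceptance (withTriangle c kk x))
        ≡⟨ sumL-cong (allFin 4) (λ x → acceptance-gadgetEdges (withTriangle c kk x)) ⟩
      sumL (allFin 4) (λ x → 𝔼 (λ u → verdict u (withTriangle c kk x)))
        ≡⟨ sumL-expect (allFin 4) m (λ x u → verdict u (withTriangle c kk x)) ⟩
      𝔼 (λ u → sumL (allFin 4) (λ x → verdict u (withTriangle c kk x)))
        ≤⟨ expect-mono m (swap-step c kk) ⟩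
      𝔼 (λ u → stars u + fromℕ 4 * 𝟙 (heavy kk u))
        ≡⟨ expect-+ m stars (λ u → fromℕ 4 * 𝟙 (heavy kk u)) ⟩
      𝔼 stars + 𝔼 (λ u → fromℕ 4 * 𝟙 (heavy kk u))
        ≡⟨ cong₂ _+_ (sym (sumL-expect (allFin 4) m (λ x u → verdict u (withStar c kk x))))
                     (expect-*ˡ m (fromℕ 4) (𝟙 ∘ heavy kk)) ⟩
      sumL (allFin 4) (λ x → 𝔼 (λ u → verdict u (withStar c kk x))) + fromℕ 4 * pHeavy kk
        ≡⟨ cong (_+ fromℕ 4 * pHeavy kk)
                (sumL-cong (allFin 4) (λ x → acceptance-gadgetEdges (withStar c kk x))) ⟨
      sumL (allFin 4) (λ x → acceptance (withStar c kk x)) + fromℕ 4 * pHeavy kk ∎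
      where
      open ≤-Reasoning
      𝔼 : (Vec GadgetEdge m → ℚ) → ℚ
      𝔼 = expect gadgetEdges ν m
      stars : Vec GadgetEdge m → ℚ
      stars u = sumL (allFin 4) (λ x → verdict u (withStar c kk x))

    Ψ : ℕ → ℚ
    Ψ k = sumL configs (λ c → acceptance (hybrid k c))

    hybrid-step : ∀ kk → Ψ (suc (toℕ kk)) ≤ Ψ (toℕ kk) + #configs * pHeavy kk
    hybrid-step kk = *-cancelˡ-≤-pos (fromℕ 4) {{positive (fromℕ-mono-< {0} {4} (ℕ.s≤s ℕ.z≤n))}} (begin
      fromℕ 4 * Ψ (suc (toℕ kk))
        ≡⟨ sumL-seqs-update (allFin 4) kk (λ c → acceptance (hybrid (suc (toℕ kk)) c)) ⟨
      sumL configs (λ c → sumL (allFin 4) (λ x → acceptance (withTriangle c kk x)))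
        ≤⟨ sumL-mono configs (λ c → config-step c kk) ⟩
      sumL configs (λ c → stars c + fromℕ 4 * pHeavy kk)
        ≡⟨ sumL-+ configs stars (λ _ → fromℕ 4 * pHeavy kk) ⟩
      sumL configs stars + sumL configs (λ _ → fromℕ 4 * pHeavy kk)
        ≡⟨ cong₂ _+_ (sumL-seqs-update (allFin 4) kk (λ c → acceptance (hybrid (toℕ kk) c)))
                     (sumL-const configs (fromℕ 4 * pHeavy kk)) ⟩
      fromℕ 4 * Ψ (toℕ kk) + #configs * (fromℕ 4 * pHeavy kk)
        ≡⟨ solve 4 (λ a ψ c p → a :* ψ :+ c :* (a :* p) := a :* (ψ :+ c :* p))
                   refl (fromℕ 4) (Ψ (toℕ kk)) #configs (pHeavy kk) ⟩
      fromℕ 4 * (Ψ (toℕ kk) + #configs * pHeavy kk) ∎)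
      where
      open ≤-Reasoning
      open +-*-Solver
      stars : Config → ℚ
      stars c = sumL (allFin 4) (λ x → acceptance (withStar c kk x))

    pHeavy≤ : ∀ kk → pHeavy kk ≤ fromℕ (m ℕ.^ 3) * q ^ℚ 3
    pHeavy≤ kk = count-tail ν-sum (λ y → proj₁ y ≟ kk) (*-nonNeg (fromℕ-nonNeg 6) w≥0)
                            (≤-reflexive (gadget-mass kk)) m 3

    Ψ-drift : Ψ n ≤ Ψ 0 + fromℕ n * (#configs * (fromℕ (m ℕ.^ 3) * q ^ℚ 3))
    Ψ-drift = telescope Ψ δ n λ k k<n →
      subst (λ k′ → Ψ (suc k′) ≤ Ψ k′ + δ) (toℕ-fromℕ< k<n) (step (Fin.fromℕ< k<n))
      where
      δ : ℚ
      δ = #configs * (fromℕ (m ℕ.^ 3) * q ^ℚ 3)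
      step : ∀ kk → Ψ (suc (toℕ kk)) ≤ Ψ (toℕ kk) + δ
      step kk = ≤-trans (hybrid-step kk)
                        (+-monoʳ-≤ (Ψ (toℕ kk)) (*-monoˡ-≤-0≤ (<⇒≤ #configs>0) (pHeavy≤ kk)))

    hybrid-gap : fromℕ n * (fromℕ (m ℕ.^ 3) * q ^ℚ 3) < + 1 / 3 →
                 (∀ c → + 2 / 3 ≤ acceptance (hybrid n c)) →
                 (∀ c → acceptance (hybrid 0 c) ≤ + 1 / 3) → ⊥
    hybrid-gap small accept reject = <-irrefl refl (begin-strict
      #configs * (+ 2 / 3)                     ≡⟨ sumL-const configs (+ 2 / 3) ⟨
      sumL configs (λ _ → + 2 / 3)             ≤⟨ sumL-mono configs accept ⟩
      Ψ n                                      ≤⟨ Ψ-drift ⟩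
      Ψ 0 + fromℕ n * (#configs * β)           ≤⟨ +-monoˡ-≤ (fromℕ n * (#configs * β)) Ψ0≤ ⟩
      #configs * (+ 1 / 3) + fromℕ n * (#configs * β) <⟨ +-monoʳ-< (#configs * (+ 1 / 3)) drift<M/3 ⟩
      #configs * (+ 1 / 3) + #configs * (+ 1 / 3) ≡⟨ *-distribˡ-+ #configs (+ 1 / 3) (+ 1 / 3) ⟨
      #configs * (+ 2 / 3)                     ∎)
      where
      open ≤-Reasoning
      β : ℚ
      β = fromℕ (m ℕ.^ 3) * q ^ℚ 3
      Ψ0≤ : Ψ 0 ≤ #configs * (+ 1 / 3)
      Ψ0≤ = ≤-trans (sumL-mono configs reject) (≤-reflexive (sumL-const configs (+ 1 / 3)))
      drift<M/3 : fromℕ n * (#configs * β) < #configs * (+ 1 / 3)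
      drift<M/3 = <-respˡ-≡ (solve 3 (λ a b c → b :* (a :* c) := a :* (b :* c)) refl (fromℕ n) #configs β)
                            (*-monoʳ-<-pos #configs {{positive #configs>0}} small)
        where open +-*-Solver

  tester-needs-many-samples : ∀ {m} (A : Algorithm (Pair N) m) → 3 ℕ.* m ℕ.^ 3 ℕ.< n ℕ.^ 2 →
                              ¬ IsTester (edges N) (IsClique N) (+ 1 / 4) A
  tester-needs-many-samples {m} A 3m³<n² (A-valid , tester) =
    hybrid-gap A A-valid (n*m³q³<1/3 n m n*q≡1 3m³<n²)
      (λ c → proj₁ (tester μ μ-isDist (hybrid n c)) (hybrid-n-isClique c))
      (λ c → proj₂ (tester μ μ-isDist (hybrid 0 c)) (hybrid-0-far c))

open import Data.Nat using (_*_; _^_; _<_; _≤_)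
open import Data.Integer using (+_)
open import Data.Rational using (_/_)
open import Relation.Nullary using (¬_)

theorem7p11 : (n : ℕ) → 1 ≤ n → (m : ℕ) → 1 ≤ m → 27 * m ^ 3 < n ^ 2 →
    (A : Algorithm (Pair (6 * n)) m) →
    ¬ IsTester (edges (6 * n)) (IsClique (6 * n)) (+ 1 / 4) A
theorem7p11 n 1≤n m _ 27m³<n² A =
  HardInstances.tester-needs-many-samples n {{ℕ.>-nonZero 1≤n}} A
    (ℕ.≤-<-trans (ℕ.*-monoˡ-≤ (m ^ 3) {3} {27} (ℕ.≤ᵇ⇒≤ 3 27 _)) 27m³<n²)
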